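{- Let $(I,\le)$ be a chain and $r:I\to\{ -1,0,+1\}$ a map. Then $Q^I_r$ is an $NE$-free poset. Consequently, for any family $(P_i)_{i\in I}$ of pairwise disjoint non-empty posets, the poset labelled sum $\sum_{i\in I}P_i=Q^I_r[P_i/i: i\in I]$ is $NE$-free if and only if every $P_i$ is $NE$-free.
   Context: $Q^I_r=(I,\le')$ is defined by: for $i<j$ in $I$, $i\perp j$ if $r(i)=0$, $i<'j$ if $r(i)=-1$, and $j<'i$ if $r(i)=+1$. A poset is $NE$-free if it has no induced subposet isomorphic to $N$: the poset on $\{a,b,c,d\}$ with $a<b$, $c<b$, $c<d$ and $a,c$; $b,d$; $a,d$ pairwise incomparable. Poset substitution $Q[P_v/v:v\in Q]$: the poset on $\bigcup_v P_v$ with $x\le y$ iff either $x,y\in P_v$ and $x\le y$ in $P_v$, or $x\in P_u$, $y\in P_v$, $u\ne v$ and $u\le v$ in $Q$. -}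

module Defs where

open import Level using (Level; _⊔_)
open import Data.Product using (Σ; _,_)
open import Relation.Nullary using (¬_)
open import Relation.Binary.Core using (Rel)
open import Relation.Binary.Bundles using (Poset)
open import Relation.Binary.PropositionalEquality using (_≡_; _≢_)

data Sign3 : Set where
  neg  : Sign3
  zer  : Sign3
  pos  : Sign3

-- The order ≤' of Q^I_r, built from the strict order _<_ of the chain I.
-- For i < j:  r i = 0 : incomparable;  r i = -1 : i <' j;  r i = +1 : j <' i.
data QLe {a ℓ} {I : Set a} (_<_ : Rel I ℓ) (r : I → Sign3) (i j : I) : Set (a ⊔ ℓ) where
  same : i ≡ j → QLe _<_ r i j
  up   : i < j → r i ≡ neg → QLe _<_ r i j
  down : j < i → r j ≡ pos → QLe _<_ r i j

-- An induced copy of N on a,b,c,d:  a<b, c<b, c<d, and a∥c, b∥d, a∥d.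
-- (Strictness and distinctness of the four points follow from the
-- incomparabilities, so ≤ suffices.)
record NPattern {c ℓ} {A : Set c} (_≤_ : Rel A ℓ) (a b c′ d : A) : Set ℓ where
  field
    a≤b : a ≤ b
    c≤b : c′ ≤ b
    c≤d : c′ ≤ d
    a≰c : ¬ (a ≤ c′)
    c≰a : ¬ (c′ ≤ a)
    b≰d : ¬ (b ≤ d)
    d≰b : ¬ (d ≤ b)
    a≰d : ¬ (a ≤ d)
    d≰a : ¬ (d ≤ a)

NEFree : ∀ {c ℓ} {A : Set c} → Rel A ℓ → Set (c ⊔ ℓ)
NEFree {A = A} _≤_ = ∀ (a b c′ d : A) → ¬ NPattern _≤_ a b c′ d

-- The labelled sum Q^I_r[P_i / i : i ∈ I] on the (automatically disjoint)
-- union Σ I (Carrier ∘ P).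
data SumLe {a ℓ c ℓ₁ ℓ₂} {I : Set a} (_<_ : Rel I ℓ) (r : I → Sign3)
           (P : I → Poset c ℓ₁ ℓ₂)
           : Rel (Σ I (λ i → Poset.Carrier (P i))) (a ⊔ ℓ ⊔ c ⊔ ℓ₂) where
  inside : ∀ {i x y} → Poset._≤_ (P i) x y → SumLe _<_ r P (i , x) (i , y)
  across : ∀ {i j x y} → i ≢ j → QLe _<_ r i j → SumLe _<_ r P (i , x) (j , y)

{-# OPTIONS --safe #-}
-- The chain order of I splits Q^I_r into a "one-sided" behaviour at each point: a point i with
-- r(i) = -1 (resp. +1) lies below (resp. above) every point after it, while a point with r(i) = 0
-- is incomparable to every point after it.  In an induced N every point has a comparable and an
-- incomparable partner, so the chain-least of the four points would have r = 0 and coincide with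
-- its comparable partner, which is impossible.
-- For the labelled sum, each block P_i is a module: a point outside it relates to all points of
-- P_i alike.  N has no nontrivial modules, so an induced N either meets four distinct blocks (and
-- projects to an N of Q^I_r) or lies inside a single block.
module Submission where

open import Defs
open import Level using (_⊔_)
open import Data.Product using (_×_; _,_; Σ; proj₁)
open import Data.Sum using (_⊎_; inj₁; inj₂; [_,_])
open import Data.Empty using (⊥; ⊥-elim)
open import Data.List using ([]; _∷_)
open import Data.List.Relation.Unary.All using (All; []; _∷_)
open import Data.List.Membership.Propositional using (_∈_)
open import Data.List.Relation.Unary.Any using (here; there)
open import Function using (id; _∘_)
open import Function.Bundles using (_⇔_; mk⇔; Equivalence)
open import Relation.Nullary using (¬_; yes; no)
open import Relation.Binary.Core using (Rel)
open import Relation.Binary.Bundles using (Poset; StrictTotalOrder; DecTotalOrder)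
open import Relation.Binary.Structures using (IsStrictTotalOrder; IsPartialOrder)
open import Relation.Binary.Properties.StrictTotalOrder using (decTotalOrder)
open import Relation.Binary.Definitions using (DecidableEquality; tri<; tri≈; tri>)
open import Relation.Binary.PropositionalEquality
  using (_≡_; _≢_; refl; sym; trans; subst; ≢-sym; isEquivalence)

open Equivalence using (to; from)
open NPattern

module _ {c₁ c₂ ℓ₁ ℓ₂} {A : Set c₁} {B : Set c₂} {_≤₁_ : Rel A ℓ₁} {_≤₂_ : Rel B ℓ₂}
         (f : A → B) (embedding : ∀ {x y} → x ≤₁ y ⇔ f x ≤₂ f y) where

  NPattern-comap : ∀ {a b c d} → NPattern _≤₂_ (f a) (f b) (f c) (f d) → NPattern _≤₁_ a b c d
  NPattern-comap n = record
    { a≤b = from embedding (a≤b n) ; c≤b = from embedding (c≤b n) ; c≤d = from embedding (c≤d n)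
    ; a≰c = a≰c n ∘ to embedding ; c≰a = c≰a n ∘ to embedding
    ; b≰d = b≰d n ∘ to embedding ; d≰b = d≰b n ∘ to embedding
    ; a≰d = a≰d n ∘ to embedding ; d≰a = d≰a n ∘ to embedding }

  NPattern-map : ∀ {a b c d} → NPattern _≤₁_ a b c d → NPattern _≤₂_ (f a) (f b) (f c) (f d)
  NPattern-map n = record
    { a≤b = to embedding (a≤b n) ; c≤b = to embedding (c≤b n) ; c≤d = to embedding (c≤d n)
    ; a≰c = a≰c n ∘ from embedding ; c≰a = c≰a n ∘ from embedding
    ; b≰d = b≰d n ∘ from embedding ; d≰b = d≰b n ∘ from embedding
    ; a≰d = a≰d n ∘ from embedding ; d≰a = d≰a n ∘ from embedding }

  NEFree-comap : NEFree _≤₂_ → NEFree _≤₁_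
  NEFree-comap free a b c d = free (f a) (f b) (f c) (f d) ∘ NPattern-map

module Chain {a ℓ} {I : Set a} {_<_ : Rel I ℓ} (sto : IsStrictTotalOrder _≡_ _<_) (r : I → Sign3) where
  open IsStrictTotalOrder sto using (compare; asym; irrefl) renaming (trans to <-trans)

  private
    chain : StrictTotalOrder a a ℓ
    chain = record { isStrictTotalOrder = sto }

  open DecTotalOrder (decTotalOrder chain) using (_≤_; totalOrder)
  open import Data.List.Extrema totalOrder using (argmin-sel; min≤⊤; min≤xs)

  private
    Q : Rel I (a ⊔ ℓ)
    Q = QLe _<_ r

  Comparable : I → I → Set (a ⊔ ℓ)
  Comparable i j = Q i j ⊎ Q j i

  neg≢pos : neg ≢ pos
  neg≢pos ()

  QLe-trans : ∀ {i j k} → Q i j → Q j k → Q i k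
  QLe-trans (same refl) q = q
  QLe-trans p (same refl) = p
  QLe-trans (up i<j ri) (up j<k _) = up (<-trans i<j j<k) ri
  QLe-trans {i} {k = k} (up _ ri) (down _ rk) with compare i k
  ... | tri< i<k _ _  = up i<k ri
  ... | tri≈ _ refl _ = same refl
  ... | tri> _ _ k<i  = down k<i rk
  QLe-trans (down _ rj) (up _ rj′) = ⊥-elim (neg≢pos (trans (sym rj′) rj))
  QLe-trans (down j<i _) (down k<j rk) = down (<-trans k<j j<i) rk

  QLe-antisym : ∀ {i j} → Q i j → Q j i → i ≡ j
  QLe-antisym (same e) _ = e
  QLe-antisym _ (same e) = sym e
  QLe-antisym (up i<j _) (up j<i _) = ⊥-elim (asym i<j j<i)
  QLe-antisym (up _ ri) (down _ ri′) = ⊥-elim (neg≢pos (trans (sym ri) ri′))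
  QLe-antisym (down _ rj) (up _ rj′) = ⊥-elim (neg≢pos (trans (sym rj′) rj))
  QLe-antisym (down j<i _) (down i<j _) = ⊥-elim (asym i<j j<i)

  QLe-isPartialOrder : IsPartialOrder _≡_ Q
  QLe-isPartialOrder = record
    { isPreorder = record { isEquivalence = isEquivalence ; reflexive = same ; trans = QLe-trans }
    ; antisym    = QLe-antisym }

  neg⇒QLe-later : ∀ {i j} → r i ≡ neg → i ≤ j → Q i j
  neg⇒QLe-later ri (inj₁ i<j) = up i<j ri
  neg⇒QLe-later _  (inj₂ i≡j) = same i≡j

  pos⇒QGe-later : ∀ {i j} → r i ≡ pos → i ≤ j → Q j i
  pos⇒QGe-later ri (inj₁ i<j) = down i<j ri
  pos⇒QGe-later _  (inj₂ i≡j) = same (sym i≡j)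

  zer⇒incomparable-later : ∀ {i j} → r i ≡ zer → i < j → ¬ Comparable i j
  zer⇒incomparable-later _  i<j (inj₁ (same refl))  = irrefl refl i<j
  zer⇒incomparable-later ri _   (inj₁ (up _ ri′))    with () ← trans (sym ri) ri′
  zer⇒incomparable-later _  i<j (inj₁ (down j<i _))  = asym i<j j<i
  zer⇒incomparable-later _  i<j (inj₂ (same refl))  = irrefl refl i<j
  zer⇒incomparable-later _  i<j (inj₂ (up j<i _))    = asym i<j j<i
  zer⇒incomparable-later ri _   (inj₂ (down _ ri′))  with () ← trans (sym ri) ri′

  earliest-comparable⇒equal : ∀ {i j k} → i ≤ j → i ≤ k → Comparable i j → ¬ Comparable i k → i ≡ j
  earliest-comparable⇒equal {i} i≤j i≤k i~j i≁k with r i in ri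
  ... | neg = ⊥-elim (i≁k (inj₁ (neg⇒QLe-later ri i≤k)))
  ... | pos = ⊥-elim (i≁k (inj₂ (pos⇒QGe-later ri i≤k)))
  ... | zer with i≤j
  ...   | inj₁ i<j = ⊥-elim (zer⇒incomparable-later ri i<j i~j)
  ...   | inj₂ i≡j = i≡j

  QLe-NEFree : NEFree Q
  QLe-NEFree a b c d n = no-point-least (argmin-sel id a bcd) (min≤⊤ a bcd) (min≤xs a bcd)
    where
      bcd = b ∷ c ∷ d ∷ []

      -- The least point is matched here rather than by 'with': abstracting over 'min a bcd'
      -- makes Agda unfold it into an exponentially large term.
      no-point-least : ∀ {m} → m ≡ a ⊎ m ∈ bcd → m ≤ a → All (m ≤_) bcd → ⊥
      no-point-least (inj₁ refl) _ (m≤b ∷ m≤c ∷ _ ∷ []) =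
        c≰a n (subst (Q c) (sym a≡b) (c≤b n))
        where a≡b = earliest-comparable⇒equal m≤b m≤c (inj₁ (a≤b n)) [ a≰c n , c≰a n ]
      no-point-least (inj₂ (here refl)) _ (_ ∷ m≤c ∷ m≤d ∷ []) =
        b≰d n (subst (λ x → Q x d) (sym b≡c) (c≤d n))
        where b≡c = earliest-comparable⇒equal m≤c m≤d (inj₂ (c≤b n)) [ b≰d n , d≰b n ]
      no-point-least (inj₂ (there (here refl))) m≤a (m≤b ∷ _ ∷ _ ∷ []) =
        a≰c n (subst (Q a) (sym c≡b) (a≤b n))
        where c≡b = earliest-comparable⇒equal m≤b m≤a (inj₁ (c≤b n)) [ c≰a n , a≰c n ]
      no-point-least (inj₂ (there (there (here refl)))) m≤a (_ ∷ m≤c ∷ _ ∷ []) =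
        d≰b n (subst (λ x → Q x b) (sym d≡c) (c≤b n))
        where d≡c = earliest-comparable⇒equal m≤c m≤a (inj₂ (c≤d n)) [ d≰a n , a≰d n ]

module LabelledSum {a ℓ c ℓ₁ ℓ₂} {I : Set a} {_<_ : Rel I ℓ} (r : I → Sign3) (P : I → Poset c ℓ₁ ℓ₂) where

  private
    Point : Set (a ⊔ c)
    Point = Σ I (Poset.Carrier ∘ P)

    _⊑_ : Rel Point (a ⊔ ℓ ⊔ c ⊔ ℓ₂)
    _⊑_ = SumLe _<_ r P

    label : Point → I
    label = proj₁

  inside⇔ : ∀ {i x y} → Poset._≤_ (P i) x y ⇔ (i , x) ⊑ (i , y)
  inside⇔ = mk⇔ inside λ { (inside x≤y) → x≤y ; (across i≢i _) → ⊥-elim (i≢i refl) }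

  across⇒QLe : ∀ {p q} → label p ≢ label q → p ⊑ q → QLe _<_ r (label p) (label q)
  across⇒QLe i≢i (inside _)    = ⊥-elim (i≢i refl)
  across⇒QLe _   (across _ pq) = pq

  across⇔ : ∀ {p q} → label p ≢ label q → p ⊑ q ⇔ QLe _<_ r (label p) (label q)
  across⇔ p≁q = mk⇔ (across⇒QLe p≁q) (across p≁q)

  block-NEFree : NEFree _⊑_ → ∀ i → NEFree (Poset._≤_ (P i))
  block-NEFree free i = NEFree-comap (i ,_) inside⇔ free

  below-block : ∀ {x y z} → label x ≡ label y → label z ≢ label x → z ⊑ x → z ⊑ y
  below-block {_ , _} {_ , _} refl z≁x z⊑x = across z≁x (across⇒QLe z≁x z⊑x)

  above-block : ∀ {x y z} → label x ≡ label y → label z ≢ label x → x ⊑ z → y ⊑ z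
  above-block {_ , _} {_ , _} refl z≁x x⊑z = across (≢-sym z≁x) (across⇒QLe (≢-sym z≁x) x⊑z)

  module _ (_≟_ : DecidableEquality I) where

    separating-below⇒same-block : ∀ {x y z} → label x ≡ label y → z ⊑ x → ¬ z ⊑ y → label z ≡ label x
    separating-below⇒same-block {x} {z = z} x~y z⊑x z⋢y with label z ≟ label x
    ... | yes z~x = z~x
    ... | no  z≁x = ⊥-elim (z⋢y (below-block x~y z≁x z⊑x))

    separating-above⇒same-block : ∀ {x y z} → label x ≡ label y → x ⊑ z → ¬ y ⊑ z → label z ≡ label x
    separating-above⇒same-block {x} {z = z} x~y x⊑z y⋢z with label z ≟ label x
    ... | yes z~x = z~x
    ... | no  z≁x = ⊥-elim (y⋢z (above-block x~y z≁x x⊑z))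

    NPattern-within-block-absurd : (∀ i → NEFree (Poset._≤_ (P i)))
                                 → ∀ {a b c d} → NPattern _⊑_ a b c d → label a ≡ label b → ⊥
    NPattern-within-block-absurd free {i , x} {_ , y} {_ , z} {_ , w} n refl
      with refl ← separating-below⇒same-block refl (c≤b n) (c≰a n)
      with refl ← separating-above⇒same-block refl (c≤d n) (a≰d n)
      = free i x y z w (NPattern-comap (i ,_) inside⇔ n)

    NPattern-across-blocks : ∀ {a b c d} → NPattern _⊑_ a b c d
      → label a ≢ label b → label a ≢ label c → label a ≢ label d
      → label b ≢ label c → label b ≢ label d → label c ≢ label d
      → NPattern (QLe _<_ r) (label a) (label b) (label c) (label d)
    NPattern-across-blocks n a≁b a≁c a≁d b≁c b≁d c≁d = record
      { a≤b = to (across⇔ a≁b) (a≤b n) ; c≤b = to (across⇔ (≢-sym b≁c)) (c≤b n)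
      ; c≤d = to (across⇔ c≁d) (c≤d n)
      ; a≰c = a≰c n ∘ from (across⇔ a≁c) ; c≰a = c≰a n ∘ from (across⇔ (≢-sym a≁c))
      ; b≰d = b≰d n ∘ from (across⇔ b≁d) ; d≰b = d≰b n ∘ from (across⇔ (≢-sym b≁d))
      ; a≰d = a≰d n ∘ from (across⇔ a≁d) ; d≰a = d≰a n ∘ from (across⇔ (≢-sym a≁d)) }

    SumLe-NEFree : NEFree (QLe _<_ r) → (∀ i → NEFree (Poset._≤_ (P i))) → NEFree _⊑_
    SumLe-NEFree Qfree Pfree a b c d n with label a ≟ label b
    ... | yes a~b = NPattern-within-block-absurd Pfree n a~b
    ... | no a≁b with label a ≟ label c
    ...   | yes a~c =
      let d~c = separating-above⇒same-block (sym a~c) (c≤d n) (a≰d n)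
          b~c = separating-above⇒same-block (sym d~c) (c≤b n) (d≰b n)
      in NPattern-within-block-absurd Pfree n (trans a~c (sym b~c))
    ...   | no a≁c with label a ≟ label d
    ...     | yes a~d =
      NPattern-within-block-absurd Pfree n (sym (separating-above⇒same-block a~d (a≤b n) (d≰b n)))
    ...     | no a≁d with label b ≟ label c
    ...       | yes b~c =
      NPattern-within-block-absurd Pfree n (separating-below⇒same-block b~c (a≤b n) (a≰c n))
    ...       | no b≁c with label b ≟ label d
    ...         | yes b~d =
      NPattern-within-block-absurd Pfree n (separating-below⇒same-block b~d (a≤b n) (a≰d n))
    ...         | no b≁d with label c ≟ label d
    ...           | yes c~d =
      let b~c = separating-above⇒same-block c~d (c≤b n) (d≰b n)
      in NPattern-within-block-absurd Pfree n (separating-below⇒same-block b~c (a≤b n) (a≰c n))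
    ...           | no c≁d =
      Qfree _ _ _ _ (NPattern-across-blocks n a≁b a≁c a≁d b≁c b≁d c≁d)

mainTheorem7 : ∀ {a ℓ c ℓ₁ ℓ₂} {I : Set a} {_<_ : Rel I ℓ}
    → IsStrictTotalOrder _≡_ _<_
    → (r : I → Sign3)
    → (IsPartialOrder _≡_ (QLe _<_ r) × NEFree (QLe _<_ r))
      × ((P : I → Poset c ℓ₁ ℓ₂) → ((i : I) → Poset.Carrier (P i))
         → (NEFree (SumLe _<_ r P) ⇔ ((i : I) → NEFree (Poset._≤_ (P i)))))
mainTheorem7 sto r = (Chain.QLe-isPartialOrder sto r , Chain.QLe-NEFree sto r) , λ P _ →
  mk⇔ (LabelledSum.block-NEFree r P)
      (LabelledSum.SumLe-NEFree r P (IsStrictTotalOrder._≟_ sto) (Chain.QLe-NEFree sto r))
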